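{- Let $A\subseteq\mathbb N$ be a finite set of positive integers forming a geometric progression whose ratio is a positive integer that is not a perfect square. Then $|\Omega_2(A)|\ge (|A|-1)|A|$.
   Context: For a finite set $B$ of non-negative reals, $\Omega_2(B)=\{\rho(M): M\in B^{2\times 2}\}$, where $B^{2\times 2}$ is the set of $2\times 2$ matrices with entries in $B$ and $\rho(M)$ is the spectral radius. -}

module Defs where

open import Data.Nat using (ℕ)
open import Data.Fin using (Fin; zero; suc)
open import Data.Integer as ℤ using (ℤ; +_)
open import Data.Rational as ℚ using (ℚ; 0ℚ)
open import Data.Sum using (_⊎_)
open import Data.Product using (_×_)
open import Function.Bundles using (_⇔_)
open import Level using (0ℓ)

Mat2 : Set
Mat2 = Fin 2 → Fin 2 → ℕ

EntriesIn : (ℕ → Set) → Mat2 → Set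
EntriesIn B M = (i j : Fin 2) → B (M i j)

-- Real numbers are represented by their (open) lower Dedekind cut on ℚ:
-- a real x is the predicate  q ↦ (q < x).
ℝcut : Set₁
ℝcut = ℚ → Set

_≈ℝ_ : ℝcut → ℝcut → Set
x ≈ℝ y = (q : ℚ) → (x q ⇔ y q)

-- Spectral radius of a non-negative 2×2 matrix M = [[p , b] , [c , s]].
-- Its eigenvalues are real: (tr ± √disc)/2, with tr = p + s ≥ 0 and
-- disc = (p - s)² + 4bc ≥ 0, so ρ(M) = (tr + √disc)/2.
-- As a lower cut:  q < ρ(M)  ⇔  2q - tr < √disc
--                             ⇔  (2q - tr < 0)  or  (2q - tr)² < disc.
trace : Mat2 → ℤ
trace M = + (M zero zero) ℤ.+ + (M (suc zero) (suc zero))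

disc : Mat2 → ℤ
disc M = d ℤ.* d ℤ.+ (+ 4) ℤ.* (+ M zero (suc zero)) ℤ.* (+ M (suc zero) zero)
  where d = + (M zero zero) ℤ.- + (M (suc zero) (suc zero))

ρ : Mat2 → ℝcut
ρ M q = (x ℚ.< 0ℚ) ⊎ (x ℚ.* x ℚ.< (disc M ℚ./ 1))
  where x = ((+ 2 ℚ./ 1)) ℚ.* q ℚ.- (trace M ℚ./ 1)

{-# OPTIONS --safe #-}
-- A matrix [[p, b], [c, p]] has spectral radius p + √(bc). Write a_i = a r^i, where r ≥ 2 as r is
-- a non-square. For i < n and t < n − 1 take the matrix with diagonal a_i and off-diagonal
-- entries a_t, a_(t+1) when i ≤ t, of radius a_i + a_t √r (irrational), and a_t, a_t when t < i,
-- of radius a_i + a_t (an integer). These n (n − 1) radii are pairwise distinct: the integers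
-- because a_i exceeds the sum of all smaller terms; the irrationals with equal t trivially, and
-- for t < t′ because a_i + a_t √r ≤ a_t (1 + √r) < r √r a_t ≤ a_t′ √r. Every comparison is
-- certified by a fraction lying between the two radii, which separates their lower cuts.
module Submission where

open import Defs
open import Data.Nat as ℕ using (ℕ; zero; suc; _+_; _*_; _∸_; _^_; _≤_; _<_; z≤n; s≤s)
import Data.Nat.Properties as ℕP
open import Data.Nat.Tactic.RingSolver as ℕ-Solver using ()
open import Data.Nat.Divisibility using (_∣_; divides; ∣-refl; ∣1⇒≡1)
open import Data.Nat.GCD using (gcd; gcd-GCD; GCD-*; gcd[m,n]≢0; module GCD)
open import Data.Nat.Coprimality using (coprime-divisor; GCD≡1⇒coprime)
import Data.Nat.Coprimality as Coprime
open import Data.Fin using (zero; suc)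
open import Data.Integer as ℤ using (ℤ; +_; _⊖_)
import Data.Integer.Properties as ℤP
open import Data.Integer.Tactic.RingSolver as ℤ-Solver using ()
open import Data.Rational as ℚ using (toℚᵘ)
import Data.Rational.Properties as ℚP
import Data.Rational.Unnormalised as ℚᵘ
open ℚᵘ using (mkℚᵘ; *≡*; *<*)
import Data.Rational.Unnormalised.Properties as ℚᵘP
open import Data.List as List using (List; []; _∷_; length; map; upTo; cartesianProduct)
import Data.List.Properties as List
open import Data.List.Membership.Propositional using (_∈_)
open import Data.List.Membership.Propositional.Properties using (∈-upTo⁻; ∈-cartesianProduct⁻)
open import Data.List.Relation.Unary.All as All using (All)
import Data.List.Relation.Unary.All.Properties as All
open import Data.List.Relation.Unary.AllPairs as AllPairs using (AllPairs)
import Data.List.Relation.Unary.AllPairs.Properties as AllPairs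
open import Data.List.Relation.Unary.Unique.Propositional using (Unique)
import Data.List.Relation.Unary.Unique.Propositional.Properties as Unique
open import Data.Product using (∃; _×_; _,_)
open import Data.Sum using (_⊎_; inj₁; inj₂; swap)
open import Data.Empty using (⊥-elim)
open import Relation.Nullary using (¬_; Dec; yes; no)
open import Relation.Binary.PropositionalEquality
open import Relation.Binary.Definitions using (tri<; tri≈; tri>)
open import Function.Bundles using (_⇔_; mk⇔; Equivalence)

gapNumerator : Mat2 → ℤ → ℕ → ℤ
gapNumerator M m d = + 2 ℤ.* m ℤ.- trace M ℤ.* + suc d

toℚᵘ-fraction : ∀ (u : ℤ) d → toℚᵘ (u ℚ./ suc d) ℚᵘ.≃ mkℚᵘ u d
toℚᵘ-fraction u d = ℚP.toℚᵘ-fromℚᵘ (mkℚᵘ u d)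

gap-toℚᵘ : ∀ M m d →
  toℚᵘ ((+ 2 ℚ./ 1) ℚ.* (m ℚ./ suc d) ℚ.- (trace M ℚ./ 1)) ℚᵘ.≃ mkℚᵘ (gapNumerator M m d) d
gap-toℚᵘ M m d =
  ℚᵘP.≃-trans (ℚP.toℚᵘ-homo-+ (two ℚ.* q) (ℚ.- t))
    (ℚᵘP.≃-trans
      (ℚᵘP.+-cong (ℚᵘP.≃-trans (ℚP.toℚᵘ-homo-* two q) (ℚᵘP.*-cong (toℚᵘ-fraction (+ 2) 0) (toℚᵘ-fraction m d)))
                  (ℚᵘP.≃-trans (ℚP.toℚᵘ-homo‿- t) (ℚᵘP.-‿cong (toℚᵘ-fraction (trace M) 0))))
      (sum-of-fractions m (trace M) d))
  where
  two = + 2 ℚ./ 1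
  q = m ℚ./ suc d
  t = trace M ℚ./ 1
  identity : ∀ m t D → (+ 2 ℤ.* m ℤ.* + 1 ℤ.+ ℤ.- t ℤ.* D) ℤ.* D ≡ (+ 2 ℤ.* m ℤ.- t ℤ.* D) ℤ.* D
  identity = ℤ-Solver.solve-∀
  cross-multiplied : ∀ m t d → (+ 2 ℤ.* m ℤ.* + 1 ℤ.+ ℤ.- t ℤ.* + suc (d + 0)) ℤ.* + suc d
                               ≡ (+ 2 ℤ.* m ℤ.- t ℤ.* + suc d) ℤ.* + suc ((d + 0) * 1)
  cross-multiplied m t d rewrite ℕP.+-identityʳ d | ℕP.*-identityʳ d = identity m t (+ suc d)
  sum-of-fractions : ∀ m t d → mkℚᵘ (+ 2) 0 ℚᵘ.* mkℚᵘ m d ℚᵘ.+ ℚᵘ.- mkℚᵘ t 0 ℚᵘ.≃ mkℚᵘ (+ 2 ℤ.* m ℤ.- t ℤ.* + suc d) d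
  sum-of-fractions m t d = *≡* (cross-multiplied m t d)

ρ-fraction : ∀ M m d → ρ M (m ℚ./ suc d) ⇔
  (gapNumerator M m d ℤ.< + 0 ⊎ gapNumerator M m d ℤ.* gapNumerator M m d ℤ.< disc M ℤ.* + (suc d * suc d))
ρ-fraction M m d = mk⇔ to from
  where
  x = (+ 2 ℚ./ 1) ℚ.* (m ℚ./ suc d) ℚ.- (trace M ℚ./ 1)
  U = gapNumerator M m d
  square-toℚᵘ : toℚᵘ (x ℚ.* x) ℚᵘ.≃ mkℚᵘ U d ℚᵘ.* mkℚᵘ U d
  square-toℚᵘ = ℚᵘP.≃-trans (ℚP.toℚᵘ-homo-* x x) (ℚᵘP.*-cong (gap-toℚᵘ M m d) (gap-toℚᵘ M m d))
  to : ρ M (m ℚ./ suc d) → U ℤ.< + 0 ⊎ U ℤ.* U ℤ.< disc M ℤ.* + (suc d * suc d)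
  to (inj₁ x<0) with ℚᵘP.<-respˡ-≃ (gap-toℚᵘ M m d) (ℚP.toℚᵘ-mono-< x<0)
  ... | *<* p = inj₁ (subst (ℤ._< + 0) (ℤP.*-identityʳ U) p)
  to (inj₂ x²<disc) with ℚᵘP.<-respʳ-≃ (toℚᵘ-fraction (disc M) 0) (ℚᵘP.<-respˡ-≃ square-toℚᵘ (ℚP.toℚᵘ-mono-< x²<disc))
  ... | *<* p = inj₂ (subst (ℤ._< _) (ℤP.*-identityʳ (U ℤ.* U)) p)
  from : U ℤ.< + 0 ⊎ U ℤ.* U ℤ.< disc M ℤ.* + (suc d * suc d) → ρ M (m ℚ./ suc d)
  from (inj₁ U<0) = inj₁ (ℚP.toℚᵘ-cancel-<
    (ℚᵘP.<-respˡ-≃ (ℚᵘP.≃-sym (gap-toℚᵘ M m d)) (*<* (subst (ℤ._< + 0) (sym (ℤP.*-identityʳ U)) U<0))))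
  from (inj₂ U²<disc) = inj₂ (ℚP.toℚᵘ-cancel-<
    (ℚᵘP.<-respʳ-≃ (ℚᵘP.≃-sym (toℚᵘ-fraction (disc M) 0))
      (ℚᵘP.<-respˡ-≃ (ℚᵘP.≃-sym square-toℚᵘ) (*<* (subst (ℤ._< _) (sym (ℤP.*-identityʳ (U ℤ.* U))) U²<disc)))))

constDiag : ℕ → ℕ → ℕ → Mat2
constDiag p b c zero       zero       = p
constDiag p b c zero       (suc zero) = b
constDiag p b c (suc zero) zero       = c
constDiag p b c (suc zero) (suc zero) = p

infix 4 _/_<_+√_
_/_<_+√_ : ℕ → ℕ → ℕ → ℕ → Set
m / D < p +√ S = p * D ≤ m → (m ∸ p * D) * (m ∸ p * D) < D * D * S

disc-constDiag : ∀ p b c → disc (constDiag p b c) ≡ + 4 ℤ.* + (b * c)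
disc-constDiag p b c = begin
  (+ p ℤ.- + p) ℤ.* (+ p ℤ.- + p) ℤ.+ + 4 ℤ.* + b ℤ.* + c ≡⟨ identity (+ p) (+ b) (+ c) ⟩
  + 4 ℤ.* (+ b ℤ.* + c)                                   ≡⟨ cong (+ 4 ℤ.*_) (sym (ℤP.pos-* b c)) ⟩
  + 4 ℤ.* + (b * c)                                       ∎
  where
  open ≡-Reasoning
  identity : ∀ p b c → (p ℤ.- p) ℤ.* (p ℤ.- p) ℤ.+ + 4 ℤ.* b ℤ.* c ≡ + 4 ℤ.* (b ℤ.* c)
  identity = ℤ-Solver.solve-∀

gapNumerator-constDiag : ∀ p b c m d → gapNumerator (constDiag p b c) (+ m) d ≡ + 2 ℤ.* (m ⊖ p * suc d)
gapNumerator-constDiag p b c m d = begin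
  + 2 ℤ.* + m ℤ.- (+ p ℤ.+ + p) ℤ.* + suc d ≡⟨ identity (+ m) (+ p) (+ suc d) ⟩
  + 2 ℤ.* (+ m ℤ.- + p ℤ.* + suc d)         ≡⟨ cong (λ n → + 2 ℤ.* (+ m ℤ.- n)) (sym (ℤP.pos-* p (suc d))) ⟩
  + 2 ℤ.* (+ m ℤ.- + (p * suc d))           ≡⟨ cong (+ 2 ℤ.*_) (ℤP.m-n≡m⊖n m (p * suc d)) ⟩
  + 2 ℤ.* (m ⊖ p * suc d)                   ∎
  where
  open ≡-Reasoning
  identity : ∀ m p D → + 2 ℤ.* m ℤ.- (p ℤ.+ p) ℤ.* D ≡ + 2 ℤ.* (m ℤ.- p ℤ.* D)
  identity = ℤ-Solver.solve-∀

square-double-<⇔ : ∀ e N → (+ 2 ℤ.* + e) ℤ.* (+ 2 ℤ.* + e) ℤ.< (+ 4 ℤ.* + N) ⇔ e * e < N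
square-double-<⇔ e N = mk⇔
  (λ lt → ℕP.*-cancelˡ-< 4 _ _ (ℤP.drop‿+<+ (subst₂ ℤ._<_ (lhs e) (sym (ℤP.pos-* 4 N)) lt)))
  (λ lt → subst₂ ℤ._<_ (sym (lhs e)) (ℤP.pos-* 4 N) (ℤ.+<+ (ℕP.*-monoʳ-< 4 lt)))
  where
  identity : ∀ e → (2 * e) * (2 * e) ≡ 4 * (e * e)
  identity = ℕ-Solver.solve-∀
  lhs : ∀ e → (+ 2 ℤ.* + e) ℤ.* (+ 2 ℤ.* + e) ≡ + (4 * (e * e))
  lhs e = trans (cong (λ x → x ℤ.* x) (sym (ℤP.pos-* 2 e)))
                (trans (sym (ℤP.pos-* (2 * e) (2 * e))) (cong +_ (identity e)))

ρ-constDiag : ∀ p b c m d → ρ (constDiag p b c) (+ m ℚ./ suc d) ⇔ m / suc d < p +√ (b * c)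
ρ-constDiag p b c m d with m ℕP.<? p * suc d
... | yes m<pD = mk⇔ (λ _ pD≤m → ⊥-elim (ℕP.<⇒≱ m<pD pD≤m))
                     (λ _ → Equivalence.from (ρ-fraction M (+ m) d) (inj₁ U<0))
  where
  M = constDiag p b c
  U<0 : gapNumerator M (+ m) d ℤ.< + 0
  U<0 rewrite gapNumerator-constDiag p b c m d | ℤP.⊖-< m<pD =
    ℤP.*-monoˡ-<-pos (+ 2) (ℤP.neg-mono-< (ℤ.+<+ (ℕP.m<n⇒0<n∸m m<pD)))
... | no m≮pD = mk⇔ to from
  where
  M = constDiag p b c
  D = suc d
  e = m ∸ p * D
  U = gapNumerator M (+ m) d
  U≡2e : U ≡ + 2 ℤ.* + e
  U≡2e = trans (gapNumerator-constDiag p b c m d) (cong (+ 2 ℤ.*_) (ℤP.⊖-≥ (ℕP.≮⇒≥ m≮pD)))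
  scaled-disc : disc M ℤ.* + (D * D) ≡ + 4 ℤ.* + (D * D * (b * c))
  scaled-disc = begin
    disc M ℤ.* + (D * D)                ≡⟨ cong (ℤ._* + (D * D)) (disc-constDiag p b c) ⟩
    + 4 ℤ.* + (b * c) ℤ.* + (D * D)     ≡⟨ ℤP.*-assoc (+ 4) (+ (b * c)) (+ (D * D)) ⟩
    + 4 ℤ.* (+ (b * c) ℤ.* + (D * D))   ≡⟨ cong (+ 4 ℤ.*_) (sym (ℤP.pos-* (b * c) (D * D))) ⟩
    + 4 ℤ.* + (b * c * (D * D))         ≡⟨ cong (λ n → + 4 ℤ.* + n) (ℕP.*-comm (b * c) (D * D)) ⟩
    + 4 ℤ.* + (D * D * (b * c))         ∎
    where open ≡-Reasoning
  to : ρ M (+ m ℚ./ D) → m / D < p +√ (b * c)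
  to r _ with Equivalence.to (ρ-fraction M (+ m) d) r
  ... | inj₁ U<0 = ⊥-elim (ℤP.+≮0 (subst (ℤ._< + 0) (trans U≡2e (sym (ℤP.pos-* 2 e))) U<0))
  ... | inj₂ U²<disc = Equivalence.to (square-double-<⇔ e (D * D * (b * c)))
                         (subst₂ ℤ._<_ (cong (λ x → x ℤ.* x) U≡2e) scaled-disc U²<disc)
  from : m / D < p +√ (b * c) → ρ M (+ m ℚ./ D)
  from below = Equivalence.from (ρ-fraction M (+ m) d) (inj₂
    (subst₂ ℤ._<_ (sym (cong (λ x → x ℤ.* x) U≡2e)) (sym scaled-disc)
      (Equivalence.from (square-double-<⇔ e (D * D * (b * c))) (below (ℕP.≮⇒≥ m≮pD)))))

infix 4 _+√_≺_+√_
record _+√_≺_+√_ (p S p′ S′ : ℕ) : Set where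
  constructor between
  field
    m d   : ℕ
    above : ¬ (m / suc d < p +√ S)
    below : m / suc d < p′ +√ S′

below-surd-mono : ∀ {m D p S p′ S′} → p ≤ p′ → S ≤ S′ → m / D < p +√ S → m / D < p′ +√ S′
below-surd-mono {m} {D} {p} {S} {p′} {S′} p≤p′ S≤S′ below p′D≤m = ℕP.≤-<-trans
  (ℕP.*-mono-≤ gap-mono gap-mono)
  (ℕP.<-≤-trans (below pD≤m) (ℕP.*-monoʳ-≤ (D * D) S≤S′))
  where
  pD≤m = ℕP.≤-trans (ℕP.*-monoˡ-≤ D p≤p′) p′D≤m
  gap-mono = ℕP.∸-monoʳ-≤ m (ℕP.*-monoˡ-≤ D p≤p′)

≺-mono : ∀ {p S q T p′ S′ q′ T′} → p′ ≤ p → S′ ≤ S → q ≤ q′ → T ≤ T′ →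
         p +√ S ≺ q +√ T → p′ +√ S′ ≺ q′ +√ T′
≺-mono p′≤p S′≤S q≤q′ T≤T′ (between m d above below) =
  between m d (λ below′ → above (below-surd-mono p′≤p S′≤S below′)) (below-surd-mono q≤q′ T≤T′ below)

square-<⇔ : ∀ x y → x * x < y * y ⇔ x < y
square-<⇔ x y = mk⇔ to (λ x<y → ℕP.*-mono-< x<y x<y)
  where
  to : x * x < y * y → x < y
  to x²<y² with x ℕP.<? y
  ... | yes x<y = x<y
  ... | no x≮y = ⊥-elim (ℕP.<⇒≱ x²<y² (ℕP.*-mono-≤ y≤x y≤x))
    where y≤x = ℕP.≮⇒≥ x≮y

below-surd-offset⇔ : ∀ p D e S → (p * D + e) / D < p +√ S ⇔ e * e < D * D * S
below-surd-offset⇔ p D e S = mk⇔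
  (λ below → subst (λ x → x * x < D * D * S) (ℕP.m+n∸m≡n (p * D) e) (below (ℕP.m≤m+n (p * D) e)))
  (λ e²<D²S _ → subst (λ x → x * x < D * D * S) (sym (ℕP.m+n∸m≡n (p * D) e)) e²<D²S)

below-integer⇔ : ∀ m D p B → m / D < p +√ (B * B) ⇔ m < (p + B) * D
below-integer⇔ m D p B with p * D ℕP.≤? m
... | no pD≰m = mk⇔ (λ _ → ℕP.<-≤-trans (ℕP.≰⇒> pD≰m) (ℕP.*-monoˡ-≤ D (ℕP.m≤m+n p B)))
                    (λ _ pD≤m → ⊥-elim (pD≰m pD≤m))
... | yes pD≤m = subst (λ n → n / D < p +√ (B * B) ⇔ n < (p + B) * D) (ℕP.m+[n∸m]≡n pD≤m)
                   (mk⇔ (λ below → shift-< (Equivalence.to (square-<⇔ e (D * B)) (rearrange below)))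
                        (λ lt → Equivalence.from (below-surd-offset⇔ p D e (B * B))
                                  (subst (e * e <_) (square-scaled D B)
                                    (Equivalence.from (square-<⇔ e (D * B)) (unshift-< lt)))))
  where
  e = m ∸ p * D
  square-scaled : ∀ D B → (D * B) * (D * B) ≡ D * D * (B * B)
  square-scaled = ℕ-Solver.solve-∀
  rearrange : (p * D + e) / D < p +√ (B * B) → e * e < (D * B) * (D * B)
  rearrange below = subst (e * e <_) (sym (square-scaled D B))
                      (Equivalence.to (below-surd-offset⇔ p D e (B * B)) below)
  split : (p + B) * D ≡ p * D + D * B
  split = trans (ℕP.*-distribʳ-+ D p B) (cong (λ n → p * D + n) (ℕP.*-comm B D))
  shift-< : e < D * B → p * D + e < (p + B) * D
  shift-< lt = subst (p * D + e <_) (sym split) (ℕP.+-monoʳ-< (p * D) lt)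
  unshift-< : p * D + e < (p + B) * D → e < D * B
  unshift-< lt = ℕP.+-cancelˡ-< (p * D) e (D * B) (subst (p * D + e <_) split lt)

infix 4 _+√_#_+√_
_+√_#_+√_ : ℕ → ℕ → ℕ → ℕ → Set
p +√ S # p′ +√ S′ = p +√ S ≺ p′ +√ S′ ⊎ p′ +√ S′ ≺ p +√ S

#⇒ρ-constDiag-≉ : ∀ {p b c p′ b′ c′} → p +√ (b * c) # p′ +√ (b′ * c′) →
                  ¬ (ρ (constDiag p b c) ≈ℝ ρ (constDiag p′ b′ c′))
#⇒ρ-constDiag-≉ {p} {b} {c} {p′} {b′} {c′} (inj₁ (between m d above below)) ρ≈ρ′ =
  above (Equivalence.to (ρ-constDiag p b c m d)
    (Equivalence.from (ρ≈ρ′ (+ m ℚ./ suc d)) (Equivalence.from (ρ-constDiag p′ b′ c′ m d) below)))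
#⇒ρ-constDiag-≉ {p} {b} {c} {p′} {b′} {c′} (inj₂ (between m d above below)) ρ≈ρ′ =
  above (Equivalence.to (ρ-constDiag p′ b′ c′ m d)
    (Equivalence.to (ρ≈ρ′ (+ m ℚ./ suc d)) (Equivalence.from (ρ-constDiag p b c m d) below)))

IsSquare : ℕ → Set
IsSquare n = ∃ λ k → k * k ≡ n

floor-sqrt : ∀ n → ∃ λ x → x * x ≤ n × n < suc x * suc x
floor-sqrt zero = 0 , z≤n , s≤s z≤n
floor-sqrt (suc n) with floor-sqrt n
... | x , x²≤n , n<[1+x]² with suc n ℕP.<? suc x * suc x
...   | yes lt = x , ℕP.m≤n⇒m≤1+n x²≤n , lt
...   | no ≮ = suc x , ℕP.≤-reflexive (sym exact) , subst (_< suc (suc x) * suc (suc x)) (sym exact) growth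
  where
  exact : suc n ≡ suc x * suc x
  exact = ℕP.≤-antisym n<[1+x]² (ℕP.≮⇒≥ ≮)
  growth : suc x * suc x < suc (suc x) * suc (suc x)
  growth = ℕP.*-mono-< (ℕP.n<1+n (suc x)) (ℕP.n<1+n (suc x))

below-integer₁⇔ : ∀ n p B → n / 1 < p +√ (B * B) ⇔ n < p + B
below-integer₁⇔ n p B = subst (λ k → n / 1 < p +√ (B * B) ⇔ n < k) (ℕP.*-identityʳ (p + B)) (below-integer⇔ n 1 p B)

integer≺surd : ∀ {p B p′ S} → (p + B) / 1 < p′ +√ S → p +√ (B * B) ≺ p′ +√ S
integer≺surd {p} {B} below =
  between (p + B) 0 (λ b → ℕP.<-irrefl refl (Equivalence.to (below-integer₁⇔ (p + B) p B) b)) below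

integer≺integer : ∀ {p p′} B B′ → p + B < p′ + B′ → p +√ (B * B) ≺ p′ +√ (B′ * B′)
integer≺integer {p} {p′} B B′ lt = integer≺surd {p} {B} {p′} {B′ * B′} (Equivalence.from (below-integer₁⇔ (p + B) p′ B′) lt)

+√-monoˡ-≺ : ∀ {p p′ S} → p < p′ → 0 < S → p +√ S ≺ p′ +√ S
+√-monoˡ-≺ {p} {p′} {suc n} p<p′ _ with floor-sqrt n
... | x , x²≤n , n<[1+x]² = between (p * 1 + suc x) 0 above below
  where
  m = p * 1 + suc x
  above : ¬ (m / 1 < p +√ suc n)
  above b = ℕP.<⇒≱ (subst (suc x * suc x <_) (ℕP.*-identityˡ (suc n))
              (Equivalence.to (below-surd-offset⇔ p 1 (suc x) (suc n)) b)) n<[1+x]²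
  gap≤x : m ∸ p′ * 1 ≤ x
  gap≤x = ℕP.m≤n+o⇒m∸n≤o m (p′ * 1)
            (subst (_≤ p′ * 1 + x) (sym (ℕP.+-suc (p * 1) x)) (ℕP.+-monoˡ-≤ x (ℕP.*-monoˡ-≤ 1 p<p′)))
  below : m / 1 < p′ +√ suc n
  below _ = subst ((m ∸ p′ * 1) * (m ∸ p′ * 1) <_) (sym (ℕP.*-identityˡ (suc n)))
              (ℕP.≤-<-trans (ℕP.*-mono-≤ gap≤x gap≤x) (s≤s x²≤n))

-- With D = 2k, the fraction w / D = k − 1/D is still ≥ √(k² − 1): indeed w² = D² (k² − 1) + 1.
surd≺integer : ∀ {p′ S p B} k → p′ + k ≡ p + B → S < k * k → p′ +√ S ≺ p +√ (B * B)
surd≺integer {p′} {S} {p} {B} (suc k0) p′+k≡p+B S<k² = between (p′ * D + w) d above below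
  where
  k = suc k0
  d = suc (2 * k0)
  D = suc d
  w = k0 * D + d
  w+1≡kD : suc w ≡ k * D
  w+1≡kD = identity k0
    where
    identity : ∀ k0 → suc (k0 * (2 + 2 * k0) + (1 + 2 * k0)) ≡ (1 + k0) * (2 + 2 * k0)
    identity = ℕ-Solver.solve-∀
  squares : k * k * (D * D) + 1 ≡ w * w + D * D
  squares = identity k0
    where
    identity : ∀ k0 → let D = 2 + 2 * k0 in
               (1 + k0) * (1 + k0) * (D * D) + 1 ≡ (k0 * D + (1 + 2 * k0)) * (k0 * D + (1 + 2 * k0)) + D * D
    identity = ℕ-Solver.solve-∀
  D²S≤w² : D * D * S ≤ w * w
  D²S≤w² = ℕP.<⇒≤ (ℕP.+-cancelʳ-< (D * D) (D * D * S) (w * w) (begin-strict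
    D * D * S + D * D   ≡⟨ trans (ℕP.+-comm (D * D * S) (D * D)) (cong (λ n → D * D + n) (ℕP.*-comm (D * D) S)) ⟩
    suc S * (D * D)     ≤⟨ ℕP.*-monoˡ-≤ (D * D) S<k² ⟩
    k * k * (D * D)     <⟨ ℕP.n<1+n _ ⟩
    suc (k * k * (D * D)) ≡⟨ ℕP.+-comm 1 _ ⟩
    k * k * (D * D) + 1 ≡⟨ squares ⟩
    w * w + D * D       ∎))
    where open ℕP.≤-Reasoning
  above : ¬ ((p′ * D + w) / D < p′ +√ S)
  above b = ℕP.<⇒≱ (Equivalence.to (below-surd-offset⇔ p′ D w S) b) D²S≤w²
  below : (p′ * D + w) / D < p +√ (B * B)
  below = Equivalence.from (below-integer⇔ (p′ * D + w) D p B) (begin-strict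
    p′ * D + w          <⟨ ℕP.+-monoʳ-< (p′ * D) (ℕP.≤-reflexive w+1≡kD) ⟩
    p′ * D + k * D      ≡⟨ ℕP.*-distribʳ-+ D p′ k ⟨
    (p′ + k) * D        ≡⟨ cong (_* D) p′+k≡p+B ⟩
    (p + B) * D         ∎)
    where open ℕP.≤-Reasoning

IsSquare-cancel-square : ∀ {g r} → 0 < g → IsSquare (g * (g * r)) → IsSquare r
IsSquare-cancel-square {g} {r} 0<g (k , k²≡g²r) =
  k₁ , trans k₁²≡g₁²r (trans (cong (λ x → x * x * r) g₁≡1) (ℕP.*-identityˡ r))
  where
  G = gcd-GCD k g
  h = gcd k g
  k₁ = _∣_.quotient (GCD.gcd∣m G)
  g₁ = _∣_.quotient (GCD.gcd∣n G)
  k≡k₁h : k ≡ k₁ * h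
  k≡k₁h = _∣_.equality (GCD.gcd∣m G)
  g≡g₁h : g ≡ g₁ * h
  g≡g₁h = _∣_.equality (GCD.gcd∣n G)
  h≢0 = gcd[m,n]≢0 k g (inj₂ (λ g≡0 → ℕP.<⇒≢ 0<g (sym g≡0)))
  instance
    h-nonZero : ℕ.NonZero h
    h-nonZero = ℕ.≢-nonZero h≢0
    h²-nonZero : ℕ.NonZero (h * h)
    h²-nonZero = ℕP.m*n≢0 h h
  G₁ : GCD.GCD k₁ g₁ 1
  G₁ = GCD-* (subst₂ (λ x y → GCD.GCD x y (1 * h)) k≡k₁h g≡g₁h (subst (GCD.GCD k g) (sym (ℕP.*-identityˡ h)) G))
  k₁²≡g₁²r : k₁ * k₁ ≡ g₁ * g₁ * r
  k₁²≡g₁²r = ℕP.*-cancelʳ-≡ (k₁ * k₁) (g₁ * g₁ * r) (h * h) (begin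
    k₁ * k₁ * (h * h)       ≡⟨ interchange k₁ h ⟩
    k₁ * h * (k₁ * h)       ≡⟨ cong (λ x → x * x) k≡k₁h ⟨
    k * k                   ≡⟨ k²≡g²r ⟩
    g * (g * r)             ≡⟨ cong (λ x → x * (x * r)) g≡g₁h ⟩
    g₁ * h * (g₁ * h * r)   ≡⟨ regroup g₁ h r ⟩
    g₁ * g₁ * r * (h * h)   ∎)
    where
    open ≡-Reasoning
    interchange : ∀ x h → x * x * (h * h) ≡ x * h * (x * h)
    interchange = ℕ-Solver.solve-∀
    regroup : ∀ x h r → x * h * (x * h * r) ≡ x * x * r * (h * h)
    regroup = ℕ-Solver.solve-∀
  g₁∣k₁ : g₁ ∣ k₁
  g₁∣k₁ = coprime-divisor (Coprime.sym (GCD≡1⇒coprime G₁))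
            (divides (r * g₁) (trans k₁²≡g₁²r (rotate g₁ r)))
    where
    rotate : ∀ x r → x * x * r ≡ r * x * x
    rotate = ℕ-Solver.solve-∀
  g₁≡1 : g₁ ≡ 1
  g₁≡1 = ∣1⇒≡1 (GCD.greatest G₁ (g₁∣k₁ , ∣-refl))

integer#surd : ∀ p B p′ S → ¬ IsSquare S → p +√ (B * B) # p′ +√ S
integer#surd p B p′ S nonsquare with p′ ℕP.≤? p + B
... | no p′≰p+B = inj₁ (integer≺surd {p} {B} {p′} {S} (λ p′≤p+B →
                    ⊥-elim (p′≰p+B (subst (_≤ p + B) (ℕP.*-identityʳ p′) p′≤p+B))))
... | yes p′≤p+B = compare (p + B ∸ p′) (ℕP.m+[n∸m]≡n p′≤p+B)
  where
  compare : ∀ k → p′ + k ≡ p + B → p +√ (B * B) # p′ +√ S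
  compare k p′+k≡p+B with ℕP.<-cmp (k * k) S
  ... | tri< k²<S _ _ = inj₁ (integer≺surd {p} {B} {p′} {S}
        (subst (λ n → n / 1 < p′ +√ S) (trans (cong (_+ k) (ℕP.*-identityʳ p′)) p′+k≡p+B)
          (Equivalence.from (below-surd-offset⇔ p′ 1 k S) (subst (k * k <_) (sym (ℕP.*-identityˡ S)) k²<S))))
  ... | tri≈ _ k²≡S _ = ⊥-elim (nonsquare (k , k²≡S))
  ... | tri> _ _ S<k² = inj₂ (surd≺integer {p′} {S} {p} {B} k p′+k≡p+B S<k²)

-- The witness is g (r + 3) / 2: g + g √r ≤ g (r + 3) / 2 by AM-GM, and g (r + 3) / 2 < g r √r as r ≥ 2.
scaled-surd≺ : ∀ {g r} → 0 < g → 2 ≤ r → g +√ (g * (g * r)) ≺ 0 +√ (g * r * (g * r * r))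
scaled-surd≺ {suc g₀} {suc (suc s)} _ (s≤s (s≤s z≤n)) = between (g * 2 + g * (3 + s)) 1 above below
  where
  g = suc g₀
  m = g * 2 + g * (3 + s)
  am-gm : ∀ g s → (g * (3 + s)) * (g * (3 + s)) ≡ 2 * 2 * (g * (g * (2 + s))) + (g * (1 + s)) * (g * (1 + s))
  am-gm = ℕ-Solver.solve-∀
  cubic : ∀ g s → (g * 2 + g * (3 + s)) * (g * 2 + g * (3 + s)) + g * g * (7 + 38 * s + 23 * s * s + 4 * s * s * s)
                  ≡ 2 * 2 * (g * (2 + s) * (g * (2 + s) * (2 + s)))
  cubic = ℕ-Solver.solve-∀
  above : ¬ (m / 2 < g +√ (g * (g * (2 + s))))
  above b = ℕP.<⇒≱ (Equivalence.to (below-surd-offset⇔ g 2 (g * (3 + s)) (g * (g * (2 + s)))) b)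
              (ℕP.≤-trans (ℕP.m≤m+n (2 * 2 * (g * (g * (2 + s)))) (g * (1 + s) * (g * (1 + s)))) (ℕP.≤-reflexive (sym (am-gm g s))))
  below : m / 2 < 0 +√ (g * (2 + s) * (g * (2 + s) * (2 + s)))
  below _ = subst (m * m <_) (cubic g s) (ℕP.m<m+n (m * m) (s≤s z≤n))

length-cartesianProduct : ∀ {A B : Set} (xs : List A) (ys : List B) →
                          length (cartesianProduct xs ys) ≡ length xs * length ys
length-cartesianProduct []       ys = refl
length-cartesianProduct (x ∷ xs) ys = begin
  length (map (x ,_) ys List.++ cartesianProduct xs ys)      ≡⟨ List.length-++ (map (x ,_) ys) ⟩
  length (map (x ,_) ys) + length (cartesianProduct xs ys)  ≡⟨ cong₂ _+_ (List.length-map (x ,_) ys)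
                                                                         (length-cartesianProduct xs ys) ⟩
  length ys + length xs * length ys                         ∎
  where open ≡-Reasoning

module GeometricProgression (a r : ℕ) (0<a : 0 < a) (2≤r : 2 ≤ r) (r-nonsquare : ¬ IsSquare r) where

  private instance
    r-nonZero : ℕ.NonZero r
    r-nonZero = ℕ.>-nonZero (ℕP.<-trans (s≤s z≤n) 2≤r)

  term : ℕ → ℕ
  term i = a * r ^ i

  term-pos : ∀ i → 0 < term i
  term-pos i = ℕP.*-mono-≤ 0<a (ℕP.m^n>0 r i)

  term-suc : ∀ i → term (suc i) ≡ term i * r
  term-suc i = identity a (r ^ i) r
    where
    identity : ∀ a x r → a * (r * x) ≡ a * x * r
    identity = ℕ-Solver.solve-∀

  term-mono : ∀ {i j} → i ≤ j → term i ≤ term j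
  term-mono i≤j = ℕP.*-monoʳ-≤ a (ℕP.^-monoʳ-≤ r i≤j)

  term-double : ∀ i → term i + term i ≤ term (suc i)
  term-double i = begin
    term i + term i   ≡⟨ cong (λ x → term i + x) (ℕP.+-identityʳ (term i)) ⟨
    2 * term i        ≤⟨ ℕP.*-monoˡ-≤ (term i) 2≤r ⟩
    r * term i        ≡⟨ ℕP.*-comm r (term i) ⟩
    term i * r        ≡⟨ term-suc i ⟨
    term (suc i)      ∎
    where open ℕP.≤-Reasoning

  term-strict : ∀ {i j} → i < j → term i < term j
  term-strict {i} i<j = ℕP.<-≤-trans (ℕP.m<m+n (term i) (term-pos i))
                          (ℕP.≤-trans (term-double i) (term-mono i<j))

  consecutive-product : ∀ t → term t * term (suc t) ≡ term t * (term t * r)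
  consecutive-product t = cong (term t *_) (term-suc t)

  consecutive-product-nonsquare : ∀ t → ¬ IsSquare (term t * term (suc t))
  consecutive-product-nonsquare t square = r-nonsquare
    (IsSquare-cancel-square (term-pos t) (subst IsSquare (consecutive-product t) square))

  -- For i ≤ t the spectral radius is term i + term t √r, for t < i it is term i + term t.
  lowerLeft : ∀ {i t} → Dec (i ≤ t) → ℕ
  lowerLeft {t = t} (yes _) = term (suc t)
  lowerLeft {t = t} (no _)  = term t

  family : ℕ × ℕ → Mat2
  family (i , t) = constDiag (term i) (term t) (lowerLeft (i ℕP.≤? t))

  surd≺surd : ∀ {i t} i′ {t′} → i ≤ t → t < t′ →
              term i +√ (term t * term (suc t)) ≺ term i′ +√ (term t′ * term (suc t′))
  surd≺surd {i} {t} i′ {t′} i≤t t<t′ =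
    ≺-mono (term-mono i≤t) (ℕP.≤-reflexive (consecutive-product t)) z≤n
           (ℕP.*-mono-≤ next≤ (ℕP.≤-trans (ℕP.*-monoˡ-≤ r next≤) (ℕP.≤-reflexive (sym (term-suc t′)))))
           (scaled-surd≺ (term-pos t) 2≤r)
    where
    next≤ : term t * r ≤ term t′
    next≤ = subst (_≤ term t′) (term-suc t) (term-mono t<t′)

  surd#surd : ∀ {i t i′ t′} → i ≤ t → i′ ≤ t′ → (i , t) ≢ (i′ , t′) →
              term i +√ (term t * term (suc t)) # term i′ +√ (term t′ * term (suc t′))
  surd#surd {i} {t} {i′} {t′} i≤t i′≤t′ ≢ with ℕP.<-cmp t t′
  ... | tri< t<t′ _ _ = inj₁ (surd≺surd i′ i≤t t<t′)
  ... | tri> _ _ t′<t = inj₂ (surd≺surd i i′≤t′ t′<t)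
  ... | tri≈ _ refl _ with ℕP.<-cmp i i′
  ...   | tri< i<i′ _ _ = inj₁ (+√-monoˡ-≺ (term-strict i<i′) surd-pos)
    where surd-pos = ℕP.*-mono-< (term-pos t) (term-pos (suc t))
  ...   | tri> _ _ i′<i = inj₂ (+√-monoˡ-≺ (term-strict i′<i) surd-pos)
    where surd-pos = ℕP.*-mono-< (term-pos t) (term-pos (suc t))
  ...   | tri≈ _ refl _ = ⊥-elim (≢ refl)

  integer-bound : ∀ {i t i′} → t < i → i < i′ → term i + term t < term i′
  integer-bound {i} t<i i<i′ = ℕP.<-≤-trans (ℕP.+-monoʳ-< (term i) (term-strict t<i))
                                 (ℕP.≤-trans (term-double i) (term-mono i<i′))

  integer#integer : ∀ {i t i′ t′} → t < i → t′ < i′ → (i , t) ≢ (i′ , t′) →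
                    term i +√ (term t * term t) # term i′ +√ (term t′ * term t′)
  integer#integer {i} {t} {i′} {t′} t<i t′<i′ ≢ with ℕP.<-cmp i i′
  ... | tri< i<i′ _ _ = inj₁ (integer≺integer (term t) (term t′) (ℕP.<-≤-trans (integer-bound t<i i<i′) (ℕP.m≤m+n _ _)))
  ... | tri> _ _ i′<i = inj₂ (integer≺integer (term t′) (term t) (ℕP.<-≤-trans (integer-bound t′<i′ i′<i) (ℕP.m≤m+n _ _)))
  ... | tri≈ _ refl _ with ℕP.<-cmp t t′
  ...   | tri< t<t′ _ _ = inj₁ (integer≺integer (term t) (term t′) (ℕP.+-monoʳ-< (term i) (term-strict t<t′)))
  ...   | tri> _ _ t′<t = inj₂ (integer≺integer (term t′) (term t) (ℕP.+-monoʳ-< (term i) (term-strict t′<t)))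
  ...   | tri≈ _ refl _ = ⊥-elim (≢ refl)

  family-# : ∀ i t i′ t′ (i≤?t : Dec (i ≤ t)) (i′≤?t′ : Dec (i′ ≤ t′)) → (i , t) ≢ (i′ , t′) →
             term i +√ (term t * lowerLeft i≤?t) # term i′ +√ (term t′ * lowerLeft i′≤?t′)
  family-# i t i′ t′ (yes i≤t) (yes i′≤t′) ≢ = surd#surd i≤t i′≤t′ ≢
  family-# i t i′ t′ (no i≰t)  (no i′≰t′)  ≢ = integer#integer (ℕP.≰⇒> i≰t) (ℕP.≰⇒> i′≰t′) ≢
  family-# i t i′ t′ (no _)    (yes _)     _ =
    integer#surd (term i) (term t) (term i′) _ (consecutive-product-nonsquare t′)
  family-# i t i′ t′ (yes _)   (no _)      _ =
    swap (integer#surd (term i′) (term t′) (term i) _ (consecutive-product-nonsquare t))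

  family-ρ-distinct : ∀ x y → x ≢ y → ¬ (ρ (family x) ≈ℝ ρ (family y))
  family-ρ-distinct (i , t) (i′ , t′) ≢ =
    #⇒ρ-constDiag-≉ {b = term t} {c = lowerLeft (i ℕP.≤? t)} {b′ = term t′} {c′ = lowerLeft (i′ ℕP.≤? t′)}
      (family-# i t i′ t′ (i ℕP.≤? t) (i′ ℕP.≤? t′) ≢)

  families : ℕ → List Mat2
  families n = map family (cartesianProduct (upTo n) (upTo (n ∸ 1)))

  length-families : ∀ n → length (families n) ≡ n * (n ∸ 1)
  length-families n = begin
    length (families n)                                     ≡⟨ List.length-map family (cartesianProduct (upTo n) (upTo (n ∸ 1))) ⟩
    length (cartesianProduct (upTo n) (upTo (n ∸ 1)))       ≡⟨ length-cartesianProduct (upTo n) (upTo (n ∸ 1)) ⟩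
    length (upTo n) * length (upTo (n ∸ 1))                 ≡⟨ cong₂ _*_ (List.length-upTo n) (List.length-upTo (n ∸ 1)) ⟩
    n * (n ∸ 1)                                             ∎
    where open ≡-Reasoning

  families-entries : ∀ {B : ℕ → Set} n → (∀ j → j < n → B (term j)) → All (EntriesIn B) (families n)
  families-entries {B} n B-term = All.map⁺ (All.tabulate λ {x} x∈ → entries x (∈-cartesianProduct⁻ _ _ x∈))
    where
    suc-bound : ∀ {t} m → t < m ∸ 1 → suc t < m
    suc-bound (suc m) t<m = s≤s t<m
    lowerLeft-entry : ∀ {i t} (i≤?t : Dec (i ≤ t)) → t < n ∸ 1 → B (lowerLeft i≤?t)
    lowerLeft-entry {t = t} (yes _) t<n-1 = B-term (suc t) (suc-bound n t<n-1)
    lowerLeft-entry {t = t} (no _)  t<n-1 = B-term t (ℕP.<-trans (ℕP.n<1+n t) (suc-bound n t<n-1))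
    entries : ∀ x → (let (i , t) = x in i ∈ upTo n × t ∈ upTo (n ∸ 1)) → EntriesIn B (family x)
    entries (i , t) (i∈ , t∈) zero       zero       = B-term i (∈-upTo⁻ i∈)
    entries (i , t) (i∈ , t∈) zero       (suc zero) = B-term t (ℕP.<-trans (ℕP.n<1+n t) (suc-bound n (∈-upTo⁻ t∈)))
    entries (i , t) (i∈ , t∈) (suc zero) zero       = lowerLeft-entry (i ℕP.≤? t) (∈-upTo⁻ t∈)
    entries (i , t) (i∈ , t∈) (suc zero) (suc zero) = B-term i (∈-upTo⁻ i∈)

  families-distinct : ∀ n → AllPairs (λ M N → ¬ (ρ M ≈ℝ ρ N)) (families n)
  families-distinct n = AllPairs.map⁺ (AllPairs.map (λ {x} {y} → family-ρ-distinct x y)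
                          (Unique.cartesianProduct⁺ (Unique.upTo⁺ n) (Unique.upTo⁺ (n ∸ 1))))

nonsquare⇒2≤r : ∀ {r} → 0 < r → ¬ IsSquare r → 2 ≤ r
nonsquare⇒2≤r {suc zero}    _ nonsquare = ⊥-elim (nonsquare (1 , refl))
nonsquare⇒2≤r {suc (suc _)} _ _         = s≤s (s≤s z≤n)

mainTheorem5 : (A : List ℕ) → Unique A → (a r : ℕ) → 0 < a → 0 < r →
    ¬ (∃ λ k → k * k ≡ r) →
    ((x : ℕ) → (x ∈ A) ⇔ (∃ λ i → (i < length A) × (x ≡ a * r ^ i))) →
    ∃ λ (L : List Mat2) → ((length A ∸ 1) * length A ≤ length L)
      × All (EntriesIn (λ x → x ∈ A)) L
      × AllPairs (λ M N → ¬ (ρ M ≈ℝ ρ N)) L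
mainTheorem5 A _ a r 0<a 0<r r-nonsquare A≡progression =
  families n , length-bound , families-entries {B = λ x → x ∈ A} n term∈A , families-distinct n
  where
  open GeometricProgression a r 0<a (nonsquare⇒2≤r 0<r r-nonsquare) r-nonsquare
  n = length A
  length-bound : (n ∸ 1) * n ≤ length (families n)
  length-bound = ℕP.≤-reflexive (trans (ℕP.*-comm (n ∸ 1) n) (sym (length-families n)))
  term∈A : ∀ j → j < n → term j ∈ A
  term∈A j j<n = Equivalence.from (A≡progression (term j)) (j , j<n , refl)
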